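{- $\mathcal{POC}[\mathcal{QF}]<\mathcal{POC}[\mathcal{FO}]$: every $\mathcal{POC}[\mathcal{QF}]$-sentence is a $\mathcal{POC}[\mathcal{FO}]$-sentence, but some $\mathcal{POC}[\mathcal{FO}]$-sentence is not equivalent to any $\mathcal{POC}[\mathcal{QF}]$-sentence.
   Context: Variables: first-order $x,y,\dots$ and Boolean $\alpha,\beta,\dots$ (ranging over $\{\perp,\top\}$). For tuples $\vec x_i=(x_{i1},\dots,x_{in_i})$ ($1\le i\le m$) of first-order variables (repetitions allowed) and distinct Boolean variables $\alpha_1,\dots,\alpha_m$, the partially-ordered connective $N_\pi\vec x_1\alpha_1\dots\vec x_m\alpha_m$ has pattern $\pi=(n_1,\dots,n_m,E)$, $E=\{(i,j,k,l):x_{ij}=x_{kl}\}$. $\mathfrak A,s\models N_\pi\vec x_1\alpha_1\dots\vec x_m\alpha_m\varphi$ iff there are $f_i:A^{n_i}\to\{\perp,\top\}$ such that for all $\vec a_i\in A^{n_i}$ with $a_{ij}=a_{kl}$ whenever $(i,j,k,l)\in E$, $\mathfrak A,s(\vec a_1/\vec x_1,\dots,\vec a_m/\vec x_m,f_1(\vec a_1)/\alpha_1,\dots,f_m(\vec a_m)/\alpha_m)\models\varphi$. $\mathcal{POC}[\mathcal{FO}]$ consists of the formulas $N_\pi\vec x_1\alpha_1\dots\vec x_m\alpha_m\varphi$ with $\varphi$ a first-order formula built from literals $\alpha,\neg\alpha$, (negated) equalities and (negated) relational atoms using $\wedge,\vee,\forall x,\exists x$ (classical semantics, $\alpha$ true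 iff $s(\alpha)=\top$); $\mathcal{POC}[\mathcal{QF}]$ is the subset where $\varphi$ is quantifier-free. $L<L'$: every $L$-sentence is equivalent (same models) to an $L'$-sentence, but not conversely. -}

module Defs where

open import Data.Nat using (ℕ; _≟_)
open import Data.Fin using (Fin; zero; suc)
open import Data.List using (List; length)
import Data.List as List
open import Data.Vec using (Vec; []; _∷_; lookup; map)
open import Data.Vec.Membership.Propositional using (_∈_)
open import Data.Bool using (Bool; true; false)
open import Data.Product using (Σ; ∃; ∃₂; _×_; _,_)
open import Data.Sum using (_⊎_)
open import Data.Empty using (⊥)
open import Data.Unit using (⊤)
open import Function using (_∘_)
open import Relation.Nullary using (¬_; yes; no)
open import Relation.Binary.PropositionalEquality using (_≡_; _≢_)

-- A (finite relational) vocabulary: the list of arities of its relation symbols.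
Vocab : Set
Vocab = List ℕ

RelSym : Vocab → Set
RelSym σ = Fin (length σ)

arity : (σ : Vocab) → RelSym σ → ℕ
arity σ r = List.lookup σ r

record Structure (σ : Vocab) : Set₁ where
  field
    Carrier : Set
    point   : Carrier                      -- domains are nonempty
    R       : (r : RelSym σ) → Vec Carrier (arity σ r) → Set

open Structure public

-- First-order formulas in negation normal form.
-- First-order variables are named by ℕ; the Boolean variables are
-- α_1,…,α_m, indexed by Fin m.

data Fm (σ : Vocab) (m : ℕ) : Set where
  bvar  : Fin m → Fm σ m
  nbvar : Fin m → Fm σ m
  eq    : ℕ → ℕ → Fm σ m
  neq   : ℕ → ℕ → Fm σ m
  rel   : (r : RelSym σ) → Vec ℕ (arity σ r) → Fm σ m
  nrel  : (r : RelSym σ) → Vec ℕ (arity σ r) → Fm σ m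
  and   : Fm σ m → Fm σ m → Fm σ m
  or    : Fm σ m → Fm σ m → Fm σ m
  all   : ℕ → Fm σ m → Fm σ m
  ex    : ℕ → Fm σ m → Fm σ m

QF : ∀ {σ m} → Fm σ m → Set
QF (bvar _)    = ⊤
QF (nbvar _)   = ⊤
QF (eq _ _)    = ⊤
QF (neq _ _)   = ⊤
QF (rel _ _)   = ⊤
QF (nrel _ _)  = ⊤
QF (and φ ψ)   = QF φ × QF ψ
QF (or φ ψ)    = QF φ × QF ψ
QF (all _ _)   = ⊥
QF (ex _ _)    = ⊥

Free : ∀ {σ m} → ℕ → Fm σ m → Set
Free v (bvar _)   = ⊥
Free v (nbvar _)  = ⊥
Free v (eq x y)   = v ≡ x ⊎ v ≡ y
Free v (neq x y)  = v ≡ x ⊎ v ≡ y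
Free v (rel _ xs) = v ∈ xs
Free v (nrel _ xs) = v ∈ xs
Free v (and φ ψ)  = Free v φ ⊎ Free v ψ
Free v (or φ ψ)   = Free v φ ⊎ Free v ψ
Free v (all x φ)  = v ≢ x × Free v φ
Free v (ex x φ)   = v ≢ x × Free v φ

_[_↦_] : {A : Set} → (ℕ → A) → ℕ → A → ℕ → A
(s [ x ↦ a ]) v with v ≟ x
... | yes _ = a
... | no  _ = s v

updVec : {A : Set} {k : ℕ} → (ℕ → A) → Vec ℕ k → Vec A k → ℕ → A
updVec s []       []       = s
updVec s (x ∷ xs) (a ∷ as) = updVec (s [ x ↦ a ]) xs as

updBlocks : {A : Set} {m : ℕ} {n : Fin m → ℕ} → (ℕ → A) →
            ((i : Fin m) → Vec ℕ (n i)) → ((i : Fin m) → Vec A (n i)) → ℕ → A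
updBlocks {m = ℕ.zero}  s x a = s
updBlocks {m = ℕ.suc m} s x a =
  updBlocks (updVec s (x zero) (a zero)) (x ∘ suc) (a ∘ suc)

⟦_⟧ : ∀ {σ m} → Fm σ m → (𝔄 : Structure σ) →
      (ℕ → Carrier 𝔄) → (Fin m → Bool) → Set
⟦ bvar i ⟧    𝔄 s b = b i ≡ true
⟦ nbvar i ⟧   𝔄 s b = b i ≡ false
⟦ eq x y ⟧    𝔄 s b = s x ≡ s y
⟦ neq x y ⟧   𝔄 s b = ¬ (s x ≡ s y)
⟦ rel r xs ⟧  𝔄 s b = R 𝔄 r (map s xs)
⟦ nrel r xs ⟧ 𝔄 s b = ¬ R 𝔄 r (map s xs)
⟦ and φ ψ ⟧   𝔄 s b = ⟦ φ ⟧ 𝔄 s b × ⟦ ψ ⟧ 𝔄 s b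
⟦ or φ ψ ⟧    𝔄 s b = ⟦ φ ⟧ 𝔄 s b ⊎ ⟦ ψ ⟧ 𝔄 s b
⟦ all x φ ⟧   𝔄 s b = (a : Carrier 𝔄) → ⟦ φ ⟧ 𝔄 (s [ x ↦ a ]) b
⟦ ex x φ ⟧    𝔄 s b = Σ (Carrier 𝔄) λ a → ⟦ φ ⟧ 𝔄 (s [ x ↦ a ]) b

-- Partially-ordered connectives N_π x⃗_1 α_1 … x⃗_m α_m φ.
-- The pattern π = (n_1,…,n_m,E) is determined by the tuples x⃗_i
-- (E = coincidences among the variables x_ij).

record POC (σ : Vocab) : Set where
  field
    m      : ℕ
    n      : Fin m → ℕ
    x      : (i : Fin m) → Vec ℕ (n i)      -- x⃗_i (repetitions allowed)
    body   : Fm σ m                          -- φ, Boolean var α_i = index i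
    closed : ∀ v → Free v body → ∃₂ λ (i : Fin m) (j : Fin (n i)) → lookup (x i) j ≡ v

open POC public

Respects : ∀ {σ} (θ : POC σ) {A : Set} → ((i : Fin (m θ)) → Vec A (n θ i)) → Set
Respects θ a = ∀ i j k l → lookup (x θ i) j ≡ lookup (x θ k) l →
                           lookup (a i) j ≡ lookup (a k) l

_,_⊨ᵖ_ : ∀ {σ} (𝔄 : Structure σ) → (ℕ → Carrier 𝔄) → POC σ → Set
𝔄 , s ⊨ᵖ θ =
  Σ ((i : Fin (m θ)) → Vec (Carrier 𝔄) (n θ i) → Bool) λ f →
    (a : (i : Fin (m θ)) → Vec (Carrier 𝔄) (n θ i)) → Respects θ a →
      ⟦ body θ ⟧ 𝔄 (updBlocks s (x θ) a) (λ i → f i (a i))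

_⊨_ : ∀ {σ} → Structure σ → POC σ → Set₀
𝔄 ⊨ θ = (s : ℕ → Carrier 𝔄) → 𝔄 , s ⊨ᵖ θ

POC-FO : Vocab → Set
POC-FO σ = POC σ

POC-QF : Vocab → Set
POC-QF σ = Σ (POC σ) λ θ → QF (body θ)

Equivalent : ∀ {σ} → POC σ → POC σ → Set₁
Equivalent {σ} θ θ' = (𝔄 : Structure σ) → (𝔄 ⊨ θ → 𝔄 ⊨ θ') × (𝔄 ⊨ θ' → 𝔄 ⊨ θ)

module Submission where

-- A POC[QF]-sentence holding in a structure also holds in every substructure:
-- restrict the Skolem functions f_i along the embedding, and observe that a
-- quantifier-free matrix is reflected by embeddings. Hence no POC[QF]-sentence
-- over the empty vocabulary separates the two-element structure from the
-- one-element one, whereas the POC[FO]-sentence ∃x ∃y x ≠ y (with m = 0) does.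

open import Defs
open import Level using (0ℓ)
open import Axiom.ExcludedMiddle using (ExcludedMiddle)
open import Data.Product using (Σ; _×_; proj₁; proj₂; _,_)
open import Relation.Nullary using (¬_; yes; no)
open import Data.Nat using (ℕ; _≟_)
open import Data.Fin using (Fin; zero; suc)
open import Data.List using ([])
open import Data.Vec using (Vec; []; _∷_; map; lookup)
open import Data.Vec.Properties using (lookup-map; map-cong; map-∘)
open import Data.Bool using (Bool; true; false)
open import Data.Unit using (⊤; tt)
open import Data.Empty using (⊥-elim)
open import Data.Sum using (inj₁; inj₂)
open import Function using (_∘_; id)
open import Function.Definitions using (Injective)
open import Relation.Binary.PropositionalEquality

record _↪_ {σ : Vocab} (𝔅 𝔄 : Structure σ) : Set where
  field
    emb        : Carrier 𝔅 → Carrier 𝔄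
    injective  : Injective _≡_ _≡_ emb
    R-reflect  : ∀ r as → R 𝔄 r (map emb as) → R 𝔅 r as
    R-preserve : ∀ r as → R 𝔅 r as → R 𝔄 r (map emb as)

module _ {A B : Set} (h : B → A) where

  [↦]-map : ∀ {s' : ℕ → A} {s : ℕ → B} → s' ≗ h ∘ s →
            ∀ y c → s' [ y ↦ h c ] ≗ h ∘ (s [ y ↦ c ])
  [↦]-map e y c v with v ≟ y
  ... | yes _ = refl
  ... | no _  = e v

  updVec-map : ∀ {k} {s' : ℕ → A} {s : ℕ → B} → s' ≗ h ∘ s →
               (xs : Vec ℕ k) (as : Vec B k) →
               updVec s' xs (map h as) ≗ h ∘ updVec s xs as
  updVec-map e []       []       = e
  updVec-map e (x ∷ xs) (a ∷ as) = updVec-map ([↦]-map e x a) xs as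

  updBlocks-map : ∀ {m} {n : Fin m → ℕ} {s' : ℕ → A} {s : ℕ → B} → s' ≗ h ∘ s →
                  (x : (i : Fin m) → Vec ℕ (n i)) (a : (i : Fin m) → Vec B (n i)) →
                  updBlocks s' x (map h ∘ a) ≗ h ∘ updBlocks s x a
  updBlocks-map {ℕ.zero}  e x a = e
  updBlocks-map {ℕ.suc m} e x a =
    updBlocks-map (updVec-map e (x zero) (a zero)) (x ∘ suc) (a ∘ suc)

module _ {σ : Vocab} {𝔅 𝔄 : Structure σ} (ι : 𝔅 ↪ 𝔄) where
  open _↪_ ι

  map-assignment : ∀ {k} {s' : ℕ → Carrier 𝔄} {s : ℕ → Carrier 𝔅} → s' ≗ emb ∘ s →
                   (xs : Vec ℕ k) → map s' xs ≡ map emb (map s xs)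
  map-assignment e xs = trans (map-cong e xs) (map-∘ emb _ xs)

  ⟦⟧-reflect : ∀ {m} (φ : Fm σ m) → QF φ → (b : Fin m → Bool)
               {s' : ℕ → Carrier 𝔄} {s : ℕ → Carrier 𝔅} → s' ≗ emb ∘ s →
               ⟦ φ ⟧ 𝔄 s' b → ⟦ φ ⟧ 𝔅 s b
  ⟦⟧-reflect (bvar i)   _ b e p = p
  ⟦⟧-reflect (nbvar i)  _ b e p = p
  ⟦⟧-reflect (eq x y)   _ b e p = injective (trans (sym (e x)) (trans p (e y)))
  ⟦⟧-reflect (neq x y)  _ b e p r = p (trans (e x) (trans (cong emb r) (sym (e y))))
  ⟦⟧-reflect (rel r xs) _ b e p = R-reflect r _ (subst (R 𝔄 r) (map-assignment e xs) p)
  ⟦⟧-reflect (nrel r xs) _ b e p q =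
    p (subst (R 𝔄 r) (sym (map-assignment e xs)) (R-preserve r _ q))
  ⟦⟧-reflect (and φ ψ) (qφ , qψ) b e (p , p') =
    ⟦⟧-reflect φ qφ b e p , ⟦⟧-reflect ψ qψ b e p'
  ⟦⟧-reflect (or φ ψ) (qφ , _) b e (inj₁ p) = inj₁ (⟦⟧-reflect φ qφ b e p)
  ⟦⟧-reflect (or φ ψ) (_ , qψ) b e (inj₂ p) = inj₂ (⟦⟧-reflect ψ qψ b e p)

  Respects-map : (θ : POC σ) (a : (i : Fin (m θ)) → Vec (Carrier 𝔅) (n θ i)) →
                 Respects θ a → Respects θ (map emb ∘ a)
  Respects-map θ a resp i j k l x≡ = begin
    lookup (map emb (a i)) j  ≡⟨ lookup-map j emb (a i) ⟩
    emb (lookup (a i) j)      ≡⟨ cong emb (resp i j k l x≡) ⟩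
    emb (lookup (a k) l)      ≡⟨ lookup-map l emb (a k) ⟨
    lookup (map emb (a k)) l  ∎
    where open ≡-Reasoning

  POC-QF-reflect : (θ : POC-QF σ) → 𝔄 ⊨ proj₁ θ → 𝔅 ⊨ proj₁ θ
  POC-QF-reflect (θ , qf) 𝔄⊨θ s = f , λ a resp →
      ⟦⟧-reflect (body θ) qf _ (updBlocks-map emb (λ _ → refl) (x θ) a)
        (proj₂ (𝔄⊨θ (emb ∘ s)) (map emb ∘ a) (Respects-map θ a resp))
    where
    f : (i : Fin (m θ)) → Vec (Carrier 𝔅) (n θ i) → Bool
    f i = proj₁ (𝔄⊨θ (emb ∘ s)) i ∘ map emb

𝟚 : Structure []
𝟚 = record { Carrier = Bool ; point = true ; R = λ () }

𝟙 : Structure []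
𝟙 = record { Carrier = ⊤ ; point = tt ; R = λ () }

𝟙↪𝟚 : 𝟙 ↪ 𝟚
𝟙↪𝟚 = record
  { emb = λ _ → true ; injective = λ _ → refl ; R-reflect = λ () ; R-preserve = λ () }

two-distinct : Fm [] 0
two-distinct = ex 0 (ex 1 (neq 0 1))

two-distinct-closed : ∀ v → ¬ Free v two-distinct
two-distinct-closed v (v≢0 , _ , inj₁ v≡0) = v≢0 v≡0
two-distinct-closed v (_ , v≢1 , inj₂ v≡1) = v≢1 v≡1

at-least-two : POC []
at-least-two = record
  { m = 0 ; n = λ () ; x = λ () ; body = two-distinct
  ; closed = λ v free → ⊥-elim (two-distinct-closed v free) }

𝟚⊨at-least-two : 𝟚 ⊨ at-least-two
𝟚⊨at-least-two s = (λ ()) , λ _ _ → false , true , λ ()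

𝟙⊭at-least-two : ¬ (𝟙 ⊨ at-least-two)
𝟙⊭at-least-two 𝟙⊨ with proj₂ (𝟙⊨ (λ _ → tt)) (λ ()) (λ ())
... | _ , _ , tt≢tt = tt≢tt refl

proposition7p2 : ExcludedMiddle 0ℓ →
    ((σ : Vocab) (θ : POC-QF σ) → Σ (POC-FO σ) λ θ' → Equivalent (proj₁ θ) θ')
    × Σ Vocab (λ σ → Σ (POC-FO σ) λ θ → (θ' : POC-QF σ) → ¬ Equivalent θ (proj₁ θ'))
proposition7p2 _ =
    (λ σ θ → proj₁ θ , λ 𝔄 → id , id)
  , [] , at-least-two , λ θ' equiv →
      𝟙⊭at-least-two
        (proj₂ (equiv 𝟙) (POC-QF-reflect 𝟙↪𝟚 θ' (proj₁ (equiv 𝟚) 𝟚⊨at-least-two)))
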